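{- $\mathrm{ex}'(n,\{\text{crossing},\text{swords}\})\in O(n)$.
   Context: Let $P$ be a set of $n$ points in convex position in the plane (the vertices of a convex $n$-gon); a triangle on $P$ is a 3-element subset of $P$. For two distinct triangles $t_1,t_2$ on $P$, label each point of $t_1\cup t_2$ by the triangle(s) containing it and read the points in their cyclic order around the polygon. The pair forms exactly one of eight configurations. (i) If $t_1,t_2$ share two vertices $u,v$: "taco" if their third vertices lie on the same side of the line $uv$, "mariposa" if on opposite sides. (ii) If they share exactly one vertex $v$: read the remaining four vertices in cyclic order starting just after $v$; "bat" if the pattern is $t_1t_1t_2t_2$ or $t_2t_2t_1t_1$, "nested" if it is $t_1t_2t_2t_1$ or $t_2t_1t_1t_2$, "crossing" if it is $t_1t_2t_1t_2$ or $t_2t_1t_2t_1$. (iii) If they share no vertex, the cyclic sequence of the six labels is, up to rotation, reflection and exchanging the roles of $t_1,t_2$, one of: "ears" $AAABBB$, "swords" $AABABB$, "david" $ABABAB$. Top/bottom variant: partition the vertices of the convex $n$-gon by a horizontal line into a top half of $\lceil n/2\rceil$ vertices and a bottom half of $\lfloor n/2\rfloor$ vertices (each half consisting of consecutive vertices along the polygon). For a set $X$ of configurations, $\mathrm{ex}'(n,X)$ is the maximum size of a family of triangles on $P$, each having exactly two vertices in the top half and one vertex in the bottom half, in which no two triangles form a configuration belonging to $X$. -}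

module Defs where

open import Data.Nat using (ℕ; _<_; _≤_; _*_; ⌈_/2⌉)
open import Data.Bool using (Bool; true; false)
open import Data.Fin using (Fin; toℕ)
open import Data.Fin.Subset using (Subset; ∣_∣; _∩_)
open import Data.Vec using (lookup; tabulate)
open import Data.List using (List; []; _∷_; _++_; reverse; drop; take; mapMaybe; allFin; length)
open import Data.List.Membership.Propositional using (_∈_)
open import Data.List.Relation.Unary.All using (All)
open import Data.List.Relation.Unary.Unique.Propositional using (Unique)
open import Data.Maybe using (Maybe; just; nothing)
open import Data.Product using (Σ; _×_; ∃-syntax)
open import Data.Sum using (_⊎_)
open import Relation.Binary.PropositionalEquality using (_≡_; _≢_)
open import Relation.Nullary using (¬_)
open import Relation.Nullary.Decidable using (⌊_⌋)
open import Data.Nat using (_<?_)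

-- Points of P: the vertices of a convex n-gon, identified with Fin n,
-- numbered 0,1,…,n-1 in cyclic order around the polygon.
-- A triangle on P is a 3-element subset of P.
Triangle : ℕ → Set
Triangle n = Subset n

IsTriangle : ∀ {n} → Subset n → Set
IsTriangle t = ∣ t ∣ ≡ 3

topHalf : ∀ n → Subset n
topHalf n = tabulate (λ i → ⌊ toℕ i <? ⌈ n /2⌉ ⌋)

TopBottomTriangle : ∀ n → Subset n → Set
TopBottomTriangle n t = IsTriangle t × ∣ t ∩ topHalf n ∣ ≡ 2

data Label : Set where
  L₁ L₂ L₁₂ : Label

label : Bool → Bool → Maybe Label
label true  true  = just L₁₂
label true  false = just L₁
label false true  = just L₂
label false false = nothing

-- The labels of the points of t₁ ∪ t₂ read in cyclic order around the
-- polygon (as a linear list starting at vertex 0; cyclic shifts are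
-- handled in the configuration predicates).
labelWord : ∀ {n} → Subset n → Subset n → List Label
labelWord {n} t₁ t₂ = mapMaybe (λ i → label (lookup t₁ i) (lookup t₂ i)) (allFin n)

rotate : ℕ → List Label → List Label
rotate k w = drop k w ++ take k w

-- crossing: exactly one shared vertex v; the remaining four labels, read
-- cyclically starting just after v, are t₁t₂t₁t₂ or t₂t₁t₂t₁.
Crossing : ∀ {n} → Subset n → Subset n → Set
Crossing t₁ t₂ = ∃[ xs ] ∃[ ys ]
  (labelWord t₁ t₂ ≡ xs ++ (L₁₂ ∷ ys) ×
   (ys ++ xs ≡ L₁ ∷ L₂ ∷ L₁ ∷ L₂ ∷ [] ⊎ ys ++ xs ≡ L₂ ∷ L₁ ∷ L₂ ∷ L₁ ∷ []))

-- swords: no shared vertex and the cyclic sequence of six labels is AABABB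
-- up to rotation, reflection and exchanging t₁,t₂.
swordsPat : Label → Label → List Label
swordsPat A B = A ∷ A ∷ B ∷ A ∷ B ∷ B ∷ []

Swords : ∀ {n} → Subset n → Subset n → Set
Swords t₁ t₂ = ∃[ k ] (k < 6 × (
     rotate k (labelWord t₁ t₂) ≡ swordsPat L₁ L₂
   ⊎ rotate k (labelWord t₁ t₂) ≡ swordsPat L₂ L₁
   ⊎ rotate k (reverse (labelWord t₁ t₂)) ≡ swordsPat L₁ L₂
   ⊎ rotate k (reverse (labelWord t₁ t₂)) ≡ swordsPat L₂ L₁))

FormsCrossingOrSwords : ∀ {n} → Subset n → Subset n → Set
FormsCrossingOrSwords t₁ t₂ = Crossing t₁ t₂ ⊎ Swords t₁ t₂

Admissible : ∀ n → List (Subset n) → Set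
Admissible n F =
  Unique F ×
  All (TopBottomTriangle n) F ×
  (∀ {t₁ t₂} → t₁ ∈ F → t₂ ∈ F → t₁ ≢ t₂ → ¬ FormsCrossingOrSwords t₁ t₂)

module Submission where

-- A triangle with two vertices in the top half and one in the bottom half is
-- a triple a < b < m ≤ c < n with m = ⌈n/2⌉.  Charge each member t = (a,b,c)
-- of an admissible family F to one of its vertices:
--   * to c, if F contains a triangle (a,b,c′) with c′ > c;
--   * otherwise to b, if F contains a triangle (a,b′,c′) with b′ > b;
--   * otherwise to a.
-- Recording the vertex and which of the three rules applied gives a charge in
-- {0,…,n-1} × {0,1,2}, and this charge is injective on F: two members with the
-- same charge but distinct would, together with the triangles witnessing the
-- rule, contain a crossing or swords pair (a short case analysis on the
-- relative order of the vertices, lemmas shared-third and shared-second).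

open import Defs
open import Data.Bool using (Bool; true; false; if_then_else_; T)
open import Data.Empty using (⊥; ⊥-elim)
open import Data.Fin using (Fin; toℕ; fromℕ<; combine)
open import Data.Fin.Patterns using (0F; 1F; 2F)
open import Data.Fin.Properties using (fromℕ<-injective; combine-injective; injective⇒≤)
open import Data.Fin.Subset using (Subset; ∣_∣; _∩_)
open import Data.List using (List; []; _∷_; _++_; reverse; map; tabulate; catMaybes; length; filterᵇ)
import Data.List as List
open import Data.List.Properties using (map-∘; map-tabulate; map-injective; ∷-injectiveʳ; length-map)
open import Data.List.Membership.Propositional using (_∈_; find; lose)
open import Data.List.Membership.Propositional.Properties using (∈-lookup; ∈-map⁻)
open import Data.List.Relation.Unary.All using (All; []; _∷_)
import Data.List.Relation.Unary.All as All
import Data.List.Relation.Unary.All.Properties as All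
open import Data.List.Relation.Unary.Any using (Any; any?; here; there)
open import Data.List.Relation.Unary.Linked using (Linked; []; [-]; _∷_)
import Data.List.Relation.Unary.Linked as Linked
import Data.List.Relation.Unary.Linked.Properties as Linked
open import Data.List.Relation.Unary.Unique.Propositional using (Unique; []; _∷_)
open import Data.Nat using (ℕ; suc; _<_; _≤_; _*_; _<ᵇ_; _<?_; _≟_; z<s; s<s; ⌈_/2⌉)
open import Data.Nat.Properties
  using (module ≤-Reasoning; <ᵇ⇒<; <⇒<ᵇ; <-asym; <-irrefl; suc-injective; <-trans; <-cmp; <⇒≢; ≮⇒≥;
         <-≤-trans; ≤-<-trans; *-comm)
open import Data.Product using (_×_; _,_; proj₁; proj₂; ∃-syntax)
open import Data.Sum using (_⊎_; inj₁; inj₂)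
open import Data.Vec using (Vec; []; _∷_; lookup)
import Data.Vec as Vec
open import Function using (_∘_; id)
open import Relation.Binary using (Decidable; tri<; tri≈; tri>)
open import Relation.Binary.PropositionalEquality
  using (_≡_; _≢_; refl; sym; trans; cong; cong₂; subst)
open import Relation.Nullary using (¬_; yes; no; Reflects; ofʸ; ofⁿ; proof)
open import Relation.Nullary.Decidable using (⌊_⌋; isYes≗does; _×-dec_; from-yes)

elements : ∀ {n} → Vec Bool n → List ℕ
elements []          = []
elements (true ∷ v)  = 0 ∷ map suc (elements v)
elements (false ∷ v) = map suc (elements v)

merge : List ℕ → List ℕ → List Label
merge []       ys       = map (λ _ → L₂) ys
merge (x ∷ xs) []       = map (λ _ → L₁) (x ∷ xs)
merge (x ∷ xs) (y ∷ ys) =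
  if x <ᵇ y then L₁ ∷ merge xs (y ∷ ys)
  else if y <ᵇ x then L₂ ∷ merge (x ∷ xs) ys
  else L₁₂ ∷ merge xs ys

module _ {x y : ℕ} (xs ys : List ℕ) where

  merge-< : x < y → merge (x ∷ xs) (y ∷ ys) ≡ L₁ ∷ merge xs (y ∷ ys)
  merge-< x<y with x <ᵇ y | <⇒<ᵇ x<y
  ... | true | _ = refl

  merge-> : y < x → merge (x ∷ xs) (y ∷ ys) ≡ L₂ ∷ merge (x ∷ xs) ys
  merge-> y<x with x <ᵇ y in x<ᵇy | y <ᵇ x | <⇒<ᵇ y<x
  ... | true  | _    | _ = ⊥-elim (<-asym y<x (<ᵇ⇒< x y (subst T (sym x<ᵇy) _)))
  ... | false | true | _ = refl

merge-≡ : ∀ x xs ys → merge (x ∷ xs) (x ∷ ys) ≡ L₁₂ ∷ merge xs ys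
merge-≡ x xs ys with x <ᵇ x in x<ᵇx
... | true  = ⊥-elim (<-irrefl refl (<ᵇ⇒< x x (subst T (sym x<ᵇx) _)))
... | false = refl

merge-suc : ∀ xs ys → merge (map suc xs) (map suc ys) ≡ merge xs ys
merge-suc []       ys = sym (map-∘ ys)
merge-suc (x ∷ xs) ys = shiftRight ys
  where
  shiftRight : ∀ ys → merge (map suc (x ∷ xs)) (map suc ys) ≡ merge (x ∷ xs) ys
  shiftRight []       = cong (L₁ ∷_) (sym (map-∘ xs))
  shiftRight (y ∷ ys) with x <ᵇ y | y <ᵇ x
  ... | true  | _     = cong (L₁ ∷_) (merge-suc xs (y ∷ ys))
  ... | false | true  = cong (L₂ ∷_) (shiftRight ys)
  ... | false | false = cong (L₁₂ ∷_) (merge-suc xs ys)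

merge-0ˡ : ∀ xs ys → merge (0 ∷ map suc xs) (map suc ys) ≡ L₁ ∷ merge (map suc xs) (map suc ys)
merge-0ˡ []       []       = refl
merge-0ˡ (x ∷ xs) []       = refl
merge-0ˡ xs       (y ∷ ys) = merge-< (map suc xs) (map suc ys) z<s

merge-0ʳ : ∀ xs ys → merge (map suc xs) (0 ∷ map suc ys) ≡ L₂ ∷ merge (map suc xs) (map suc ys)
merge-0ʳ []       ys = refl
merge-0ʳ (x ∷ xs) ys = merge-> (map suc xs) (map suc ys) z<s

labelsAlong : ∀ {n} → Vec Bool n → Vec Bool n → List Label
labelsAlong v w = catMaybes (tabulate (λ i → label (lookup v i) (lookup w i)))

labelWord≡merge : ∀ {n} (t₁ t₂ : Subset n) → labelWord t₁ t₂ ≡ merge (elements t₁) (elements t₂)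
labelWord≡merge t₁ t₂ =
  trans (cong catMaybes (map-tabulate id (λ i → label (lookup t₁ i) (lookup t₂ i)))) (along t₁ t₂)
  where
  along   : ∀ {n} (v w : Vec Bool n) → labelsAlong v w ≡ merge (elements v) (elements w)
  shifted : ∀ {n} (v w : Vec Bool n) →
            labelsAlong v w ≡ merge (map suc (elements v)) (map suc (elements w))
  shifted v w = trans (along v w) (sym (merge-suc (elements v) (elements w)))

  along []          []          = refl
  along (true ∷ v)  (true ∷ w)  = cong (L₁₂ ∷_) (shifted v w)
  along (true ∷ v)  (false ∷ w) = trans (cong (L₁ ∷_) (shifted v w)) (sym (merge-0ˡ (elements v) (elements w)))
  along (false ∷ v) (true ∷ w)  = trans (cong (L₂ ∷_) (shifted v w)) (sym (merge-0ʳ (elements v) (elements w)))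
  along (false ∷ v) (false ∷ w) = shifted v w

zero∉shifted : ∀ {ys} xs → 0 ∷ ys ≢ map suc xs
zero∉shifted []       ()
zero∉shifted (x ∷ xs) ()

elements-injective : ∀ {n} (v w : Vec Bool n) → elements v ≡ elements w → v ≡ w
elements-injective []          []          _ = refl
elements-injective (true ∷ v)  (true ∷ w)  e =
  cong (true ∷_) (elements-injective v w (map-injective suc-injective (∷-injectiveʳ e)))
elements-injective (false ∷ v) (false ∷ w) e =
  cong (false ∷_) (elements-injective v w (map-injective suc-injective e))
elements-injective (true ∷ v)  (false ∷ w) e = ⊥-elim (zero∉shifted (elements w) e)
elements-injective (false ∷ v) (true ∷ w)  e = ⊥-elim (zero∉shifted (elements v) (sym e))

size≡length : ∀ {n} (v : Vec Bool n) → ∣ v ∣ ≡ length (elements v)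
size≡length []          = refl
size≡length (true ∷ v)  = cong suc (trans (size≡length v) (sym (length-map suc (elements v))))
size≡length (false ∷ v) = trans (size≡length v) (sym (length-map suc (elements v)))

elements-increasing : ∀ {n} (v : Vec Bool n) → Linked _<_ (elements v)
elements-increasing []          = []
elements-increasing (true ∷ v)  = zero-first (elements-increasing v)
  where
  zero-first : ∀ {xs} → Linked _<_ xs → Linked _<_ (0 ∷ map suc xs)
  zero-first []        = [-]
  zero-first [-]       = z<s ∷ [-]
  zero-first (p ∷ ps)  = z<s ∷ Linked.map⁺ (Linked.map s<s (p ∷ ps))
elements-increasing (false ∷ v) = Linked.map⁺ (Linked.map s<s (elements-increasing v))

elements-bounded : ∀ {n} (v : Vec Bool n) → All (_< n) (elements v)
elements-bounded []          = []
elements-bounded (true ∷ v)  = z<s ∷ All.map⁺ (All.map s<s (elements-bounded v))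
elements-bounded (false ∷ v) = All.map⁺ (All.map s<s (elements-bounded v))

filterᵇ-shift : ∀ (G : ℕ → Bool) xs → map suc (filterᵇ (G ∘ suc) xs) ≡ filterᵇ G (map suc xs)
filterᵇ-shift G []       = refl
filterᵇ-shift G (x ∷ xs) with G (suc x)
... | true  = cong (suc x ∷_) (filterᵇ-shift G xs)
... | false = filterᵇ-shift G xs

elements-∩ : ∀ {n} (G : ℕ → Bool) (v : Vec Bool n) →
             elements (v ∩ Vec.tabulate (G ∘ toℕ)) ≡ filterᵇ G (elements v)
elements-∩ G []          = refl
elements-∩ G (true ∷ v)  with G 0
... | true  = cong (0 ∷_) (trans (cong (map suc) (elements-∩ (G ∘ suc) v)) (filterᵇ-shift G (elements v)))
... | false = trans (cong (map suc) (elements-∩ (G ∘ suc) v)) (filterᵇ-shift G (elements v))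
elements-∩ G (false ∷ v) = trans (cong (map suc) (elements-∩ (G ∘ suc) v)) (filterᵇ-shift G (elements v))

-- Triangles are handled through their three vertices listed increasingly.
Triple : Set
Triple = ℕ × ℕ × ℕ

first second third : Triple → ℕ
first  (a , _ , _) = a
second (_ , b , _) = b
third  (_ , _ , c) = c

vertexList : Triple → List ℕ
vertexList (a , b , c) = a ∷ b ∷ c ∷ []

firstThree : List ℕ → Triple
firstThree (a ∷ b ∷ c ∷ _) = a , b , c
firstThree _               = 0 , 0 , 0

SplitAt : ℕ → ℕ → Triple → Set
SplitAt m n t = first t < second t × second t < m × m ≤ third t × third t < n

splitTriple : ∀ {m n} (below : ℕ → Bool) → (∀ j → Reflects (j < m) (below j)) →
              ∀ xs → length xs ≡ 3 → Linked _<_ xs → All (_< n) xs →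
              length (filterᵇ below xs) ≡ 2 →
              xs ≡ vertexList (firstThree xs) × SplitAt m n (firstThree xs)
splitTriple below spec (a ∷ b ∷ c ∷ []) _ (a<b ∷ b<c ∷ [-]) (_ ∷ _ ∷ c<n ∷ []) two
  with below a | spec a
... | false | ofⁿ a≮m with below b | spec b
...   | true  | ofʸ b<m = ⊥-elim (a≮m (<-trans a<b b<m))
...   | false | _       with below c | spec c
...     | true  | ofʸ c<m = ⊥-elim (a≮m (<-trans a<b (<-trans b<c c<m)))
...     | false | _       with () ← two
splitTriple below spec (a ∷ b ∷ c ∷ []) _ (a<b ∷ b<c ∷ [-]) (_ ∷ _ ∷ c<n ∷ []) two
  | true  | _ with below b | spec b
...   | false | ofⁿ b≮m with below c | spec c
...     | true  | ofʸ c<m = ⊥-elim (b≮m (<-trans b<c c<m))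
...     | false | _       with () ← two
splitTriple below spec (a ∷ b ∷ c ∷ []) _ (a<b ∷ b<c ∷ [-]) (_ ∷ _ ∷ c<n ∷ []) two
  | true  | _ | true  | ofʸ b<m with below c | spec c
...     | true  | _       with () ← two
...     | false | ofⁿ c≮m = refl , a<b , b<m , ≮⇒≥ c≮m , c<n

corners : ∀ {n} → Subset n → Triple
corners t = firstThree (elements t)

topBottom-corners : ∀ {n} (t : Subset n) → TopBottomTriangle n t →
                    elements t ≡ vertexList (corners t) × SplitAt ⌈ n /2⌉ n (corners t)
topBottom-corners {n} t (size3 , top2) =
  splitTriple _ lowerHalf (elements t) (trans (sym (size≡length t)) size3)
    (elements-increasing t) (elements-bounded t)
    (trans (cong length (sym (elements-∩ (λ j → ⌊ j <? ⌈ n /2⌉ ⌋) t)))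
           (trans (sym (size≡length (t ∩ topHalf n))) top2))
  where
  lowerHalf : ∀ j → Reflects (j < ⌈ n /2⌉) ⌊ j <? ⌈ n /2⌉ ⌋
  lowerHalf j = subst (Reflects _) (sym (isYes≗does (j <? ⌈ n /2⌉))) (proof (j <? ⌈ n /2⌉))

-- The forbidden configurations as properties of a label word; by definition
-- FormsCrossingOrSwords t₁ t₂ is Forbidden (labelWord t₁ t₂).
CrossingWord : List Label → Set
CrossingWord w = ∃[ xs ] ∃[ ys ]
  (w ≡ xs ++ (L₁₂ ∷ ys) ×
   (ys ++ xs ≡ L₁ ∷ L₂ ∷ L₁ ∷ L₂ ∷ [] ⊎ ys ++ xs ≡ L₂ ∷ L₁ ∷ L₂ ∷ L₁ ∷ []))

SwordsWord : List Label → Set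
SwordsWord w = ∃[ k ] (k < 6 × (
     rotate k w ≡ swordsPat L₁ L₂
   ⊎ rotate k w ≡ swordsPat L₂ L₁
   ⊎ rotate k (reverse w) ≡ swordsPat L₁ L₂
   ⊎ rotate k (reverse w) ≡ swordsPat L₂ L₁))

Forbidden : List Label → Set
Forbidden w = CrossingWord w ⊎ SwordsWord w

word : Triple → Triple → List Label
word t s = merge (vertexList t) (vertexList s)

infixr 5 _⟫_
_⟫_ : ∀ {l : Label} {w r r′ : List Label} → w ≡ l ∷ r → r ≡ r′ → w ≡ l ∷ r′
p ⟫ q = trans p (cong (_ ∷_) q)

reading : ∀ {w w′ : List Label} → w ≡ w′ → Forbidden w′ → Forbidden w
reading w≡w′ = subst Forbidden (sym w≡w′)

crossing-last : ∀ {a b c a′ b′} → a < a′ → a′ < b → b < b′ → b′ < c → Forbidden (word (a , b , c) (a′ , b′ , c))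
crossing-last {b = b} {c} {b′ = b′} p q r s = reading
  (merge-< (b ∷ c ∷ []) (b′ ∷ c ∷ []) p ⟫ merge-> (c ∷ []) (b′ ∷ c ∷ []) q ⟫
   merge-< (c ∷ []) (c ∷ []) r ⟫ merge-> [] (c ∷ []) s ⟫ merge-≡ c [] [])
  (inj₁ (L₁ ∷ L₂ ∷ L₁ ∷ L₂ ∷ [] , [] , refl , inj₁ refl))

crossing-first : ∀ {a b c b′ c′} → b < b′ → b′ < c → c < c′ → Forbidden (word (a , b , c) (a , b′ , c′))
crossing-first {a} {b} {c} {b′} {c′} p q r = reading
  (merge-≡ a (b ∷ c ∷ []) (b′ ∷ c′ ∷ []) ⟫ merge-< (c ∷ []) (c′ ∷ []) p ⟫
   merge-> [] (c′ ∷ []) q ⟫ merge-< [] [] r)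
  (inj₁ ([] , L₁ ∷ L₂ ∷ L₁ ∷ L₂ ∷ [] , refl , inj₁ refl))

crossing-middle : ∀ {a b c a′ c′} → a < a′ → a′ < b → c < c′ → Forbidden (word (a , b , c) (a′ , b , c′))
crossing-middle {b = b} {c} {c′ = c′} p q r = reading
  (merge-< (b ∷ c ∷ []) (b ∷ c′ ∷ []) p ⟫ merge-> (c ∷ []) (b ∷ c′ ∷ []) q ⟫
   merge-≡ b (c ∷ []) (c′ ∷ []) ⟫ merge-< [] [] r)
  (inj₁ (L₁ ∷ L₂ ∷ [] , L₁ ∷ L₂ ∷ [] , refl , inj₁ refl))

crossing-hinge : ∀ {a b c b′ c′} → a < b → b < b′ → b′ < c → c < c′ → Forbidden (word (a , b , c) (b , b′ , c′))
crossing-hinge {b = b} {c} {b′} {c′} p q r s = reading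
  (merge-< (b ∷ c ∷ []) (b′ ∷ c′ ∷ []) p ⟫ merge-≡ b (c ∷ []) (b′ ∷ c′ ∷ []) ⟫
   merge-> [] (c′ ∷ []) r ⟫ merge-< [] [] s)
  (inj₁ (L₁ ∷ [] , L₂ ∷ L₁ ∷ L₂ ∷ [] , refl , inj₂ refl))

-- a < a′ < b′ < b < c′ and c < c′: swords t₁t₂t₂t₁t₁t₂.
swords-nested : ∀ {a b c a′ b′ c′} → a < a′ → a′ < b′ → b′ < b → b < c′ → c < c′ →
                Forbidden (word (a , b , c) (a′ , b′ , c′))
swords-nested {b = b} {c} {b′ = b′} {c′} p q r s u = reading
  (merge-< (b ∷ c ∷ []) (b′ ∷ c′ ∷ []) p ⟫ merge-> (c ∷ []) (b′ ∷ c′ ∷ []) (<-trans q r) ⟫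
   merge-> (c ∷ []) (c′ ∷ []) r ⟫ merge-< (c ∷ []) [] s ⟫ merge-< [] [] u)
  (inj₂ (3 , from-yes (3 <? 6) , inj₁ refl))

-- a < b < a′ < b′ < c < c′: swords t₁t₁t₂t₂t₁t₂.
swords-apart : ∀ {a b c a′ b′ c′} → a < b → b < a′ → a′ < b′ → b′ < c → c < c′ →
               Forbidden (word (a , b , c) (a′ , b′ , c′))
swords-apart {b = b} {c} {b′ = b′} {c′} p q r s u = reading
  (merge-< (b ∷ c ∷ []) (b′ ∷ c′ ∷ []) (<-trans p q) ⟫ merge-< (c ∷ []) (b′ ∷ c′ ∷ []) q ⟫
   merge-> [] (b′ ∷ c′ ∷ []) (<-trans r s) ⟫ merge-> [] (c′ ∷ []) s ⟫ merge-< [] [] u)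
  (inj₂ (2 , from-yes (2 <? 6) , inj₂ (inj₁ refl)))

-- a < a′ < b < b′ < c′ < c: swords t₁t₂t₁t₂t₂t₁.
swords-alternating : ∀ {a b c a′ b′ c′} → a < a′ → a′ < b → b < b′ → b′ < c′ → c′ < c →
                     Forbidden (word (a , b , c) (a′ , b′ , c′))
swords-alternating {b = b} {c} {b′ = b′} {c′} p q r s u = reading
  (merge-< (b ∷ c ∷ []) (b′ ∷ c′ ∷ []) p ⟫ merge-> (c ∷ []) (b′ ∷ c′ ∷ []) q ⟫
   merge-< (c ∷ []) (c′ ∷ []) r ⟫ merge-> [] (c′ ∷ []) (<-trans s u) ⟫ merge-> [] [] u)
  (inj₂ (5 , from-yes (5 <? 6) , inj₁ refl))

module _ {A : Set} where

  lookup-injective : ∀ {xs : List A} → Unique xs → ∀ i j → List.lookup xs i ≡ List.lookup xs j → i ≡ j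
  lookup-injective (_   ∷ _) Fin.zero    Fin.zero    _ = refl
  lookup-injective (x∉ ∷ _) Fin.zero    (Fin.suc j) e = ⊥-elim (All.lookup x∉ (∈-lookup j) e)
  lookup-injective (x∉ ∷ _) (Fin.suc i) Fin.zero    e = ⊥-elim (All.lookup x∉ (∈-lookup i) (sym e))
  lookup-injective (_   ∷ u) (Fin.suc i) (Fin.suc j) e = cong Fin.suc (lookup-injective u i j e)

  unique-length≤ : ∀ {xs : List A} {K} → Unique xs → (key : ∀ {x} → x ∈ xs → Fin K) →
                   (∀ {x y} (p : x ∈ xs) (q : y ∈ xs) → key p ≡ key q → x ≡ y) → length xs ≤ K
  unique-length≤ u key inj =
    injective⇒≤ (λ {i} {j} e → lookup-injective u i j (inj (∈-lookup i) (∈-lookup j) e))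

  unique-map : ∀ {B : Set} {f : A → B} {xs : List A} →
               (∀ {x y} → x ∈ xs → y ∈ xs → f x ≡ f y → x ≡ y) → Unique xs → Unique (map f xs)
  unique-map inj []        = []
  unique-map inj (x∉ ∷ u) =
    All.map⁺ (All.tabulate (λ y∈xs fx≡fy → All.lookup x∉ y∈xs (inj (here refl) (there y∈xs) fx≡fy)))
    ∷ unique-map (λ p q → inj (there p) (there q)) u

pair-injective : ∀ {K L x y} {i j : Fin L} (x<K : x < K) (y<K : y < K) →
                 combine (fromℕ< x<K) i ≡ combine (fromℕ< y<K) j → x ≡ y × i ≡ j
pair-injective x<K y<K e with combine-injective _ _ _ _ e
... | same , i≡j = fromℕ<-injective _ _ x<K y<K same , i≡j

_⊏₃_ _⊏₂_ : Triple → Triple → Set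
t ⊏₃ s = first t ≡ first s × second t ≡ second s × third t < third s
t ⊏₂ s = first t ≡ first s × second t < second s

_⊏₃?_ : Decidable _⊏₃_
t ⊏₃? s = (first t ≟ first s) ×-dec (second t ≟ second s) ×-dec (third t <? third s)

_⊏₂?_ : Decidable _⊏₂_
t ⊏₂? s = (first t ≟ first s) ×-dec (second t <? second s)

module FreeFamily {m n : ℕ} {T : List Triple}
  (split : All (SplitAt m n) T)
  (free  : ∀ {t s} → t ∈ T → s ∈ T → t ≢ s → ¬ Forbidden (word t s)) where

  first<second : ∀ {t} → t ∈ T → first t < second t
  first<second t∈T = proj₁ (All.lookup split t∈T)

  -- Every second vertex lies below the threshold m, every third vertex above it.
  second<third : ∀ {t s} → t ∈ T → s ∈ T → second t < third s
  second<third t∈T s∈T =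
    <-≤-trans (proj₁ (proj₂ (All.lookup split t∈T))) (proj₁ (proj₂ (proj₂ (All.lookup split s∈T))))

  third<n : ∀ {t} → t ∈ T → third t < n
  third<n t∈T = proj₂ (proj₂ (proj₂ (All.lookup split t∈T)))

  second<n : ∀ {t} → t ∈ T → second t < n
  second<n t∈T = <-trans (second<third t∈T t∈T) (third<n t∈T)

  first<n : ∀ {t} → t ∈ T → first t < n
  first<n t∈T = <-trans (first<second t∈T) (second<n t∈T)

  compatible : ∀ {a b c a′ b′ c′} → (a , b , c) ∈ T → (a′ , b′ , c′) ∈ T → a ≢ a′ ⊎ b ≢ b′ →
               ¬ Forbidden (word (a , b , c) (a′ , b′ , c′))
  compatible t∈T s∈T (inj₁ a≢a′) = free t∈T s∈T (λ { refl → a≢a′ refl })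
  compatible t∈T s∈T (inj₂ b≢b′) = free t∈T s∈T (λ { refl → b≢b′ refl })

  shared-third : ∀ {a b c a′ b′ d} → (a , b , c) ∈ T → (a′ , b′ , c) ∈ T → (a′ , b′ , d) ∈ T →
                 c < d → a < a′ ⊎ (a ≡ a′ × b < b′) → ⊥
  shared-third {a} t s s↑ c<d (inj₂ (refl , b<b′)) =
    compatible t s↑ (inj₂ (<⇒≢ b<b′)) (crossing-first {a = a} b<b′ (second<third s s) c<d)
  shared-third {b = b} {a′ = a′} {b′ = b′} t s s↑ c<d (inj₁ a<a′) with <-cmp b a′
  ... | tri< b<a′ _ _ = compatible t s↑ (inj₁ (<⇒≢ a<a′))
                          (swords-apart (first<second t) b<a′ (first<second s) (second<third s s) c<d)
  ... | tri≈ _ refl _ = compatible t s↑ (inj₁ (<⇒≢ a<a′))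
                          (crossing-hinge (first<second t) (first<second s) (second<third s s) c<d)
  ... | tri> _ _ a′<b with <-cmp b b′
  ...   | tri< b<b′ _ _ = compatible t s (inj₁ (<⇒≢ a<a′))
                            (crossing-last a<a′ a′<b b<b′ (second<third s s))
  ...   | tri≈ _ refl _ = compatible t s↑ (inj₁ (<⇒≢ a<a′)) (crossing-middle a<a′ a′<b c<d)
  ...   | tri> _ _ b′<b = compatible t s↑ (inj₁ (<⇒≢ a<a′))
                            (swords-nested a<a′ (first<second s) b′<b (second<third t s↑) c<d)

  shared-second : ∀ {a b c a′ c′ b₃ c₃} → (a , b , c) ∈ T → (a′ , b , c′) ∈ T → (a′ , b₃ , c₃) ∈ T →
                  a < a′ → b < b₃ → ⊥
  shared-second {c = c} {a′ = a′} {c′ = c′} {c₃ = c₃} t s h a<a′ b<b₃ with <-cmp c₃ c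
  ... | tri< c₃<c _ _ = compatible t h (inj₁ (<⇒≢ a<a′))
                          (swords-alternating a<a′ (first<second s) b<b₃ (second<third h h) c₃<c)
  ... | tri≈ _ refl _ = compatible t h (inj₁ (<⇒≢ a<a′))
                          (crossing-last a<a′ (first<second s) b<b₃ (second<third h h))
  ... | tri> _ _ c<c₃ with c <? c′
  ...   | yes c<c′ = compatible t s (inj₁ (<⇒≢ a<a′)) (crossing-middle a<a′ (first<second s) c<c′)
  ...   | no  c≮c′ = compatible s h (inj₂ (<⇒≢ b<b₃))
                       (crossing-first {a = a′} b<b₃ (second<third h s) (≤-<-trans (≮⇒≥ c≮c′) c<c₃))

  RaisableThird RaisableSecond : Triple → Set
  RaisableThird  t = Any (t ⊏₃_) T
  RaisableSecond t = Any (t ⊏₂_) T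

  unraisable-unique : ∀ {t s} → t ∈ T → s ∈ T → first t ≡ first s → second t ≡ second s →
                      ¬ RaisableThird t → ¬ RaisableThird s → t ≡ s
  unraisable-unique {a , b , c} {.a , .b , c′} t∈T s∈T refl refl t↑ s↑ with <-cmp c c′
  ... | tri< c<c′ _ _ = ⊥-elim (t↑ (lose s∈T (refl , refl , c<c′)))
  ... | tri≈ _ refl _ = refl
  ... | tri> _ _ c′<c = ⊥-elim (s↑ (lose t∈T (refl , refl , c′<c)))

  third-determines : ∀ {t s} → t ∈ T → s ∈ T → RaisableThird t → RaisableThird s →
                     third t ≡ third s → t ≡ s
  third-determines {a , b , c} {a′ , b′ , .c} t∈T s∈T t↑ s↑ refl
    with find t↑ | find s↑
  ... | (_ , _ , _) , t′∈T , refl , refl , c<d | (_ , _ , _) , s′∈T , refl , refl , c<d′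
    with <-cmp a a′
  ... | tri< a<a′ _ _ = ⊥-elim (shared-third t∈T s∈T s′∈T c<d′ (inj₁ a<a′))
  ... | tri> _ _ a′<a = ⊥-elim (shared-third s∈T t∈T t′∈T c<d (inj₁ a′<a))
  ... | tri≈ _ refl _ with <-cmp b b′
  ...   | tri< b<b′ _ _ = ⊥-elim (shared-third t∈T s∈T s′∈T c<d′ (inj₂ (refl , b<b′)))
  ...   | tri> _ _ b′<b = ⊥-elim (shared-third s∈T t∈T t′∈T c<d (inj₂ (refl , b′<b)))
  ...   | tri≈ _ refl _ = refl

  second-determines : ∀ {t s} → t ∈ T → s ∈ T → ¬ RaisableThird t → ¬ RaisableThird s →
                      RaisableSecond t → RaisableSecond s → second t ≡ second s → t ≡ s
  second-determines {a , b , _} {a′ , .b , _} t∈T s∈T t↑₃ s↑₃ t↑ s↑ refl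
    with find t↑ | find s↑ | <-cmp a a′
  ... | _ | (_ , _) , s′∈T , refl , b<b₃ | tri< a<a′ _ _ = ⊥-elim (shared-second t∈T s∈T s′∈T a<a′ b<b₃)
  ... | (_ , _) , t′∈T , refl , b<b₃ | _ | tri> _ _ a′<a = ⊥-elim (shared-second s∈T t∈T t′∈T a′<a b<b₃)
  ... | _ | _ | tri≈ _ a≡a′ _ = unraisable-unique t∈T s∈T a≡a′ refl t↑₃ s↑₃

  first-determines : ∀ {t s} → t ∈ T → s ∈ T → ¬ RaisableThird t → ¬ RaisableThird s →
                     ¬ RaisableSecond t → ¬ RaisableSecond s → first t ≡ first s → t ≡ s
  first-determines {a , b , _} {.a , b′ , _} t∈T s∈T t↑₃ s↑₃ t↑ s↑ refl with <-cmp b b′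
  ... | tri< b<b′ _ _ = ⊥-elim (t↑ (lose s∈T (refl , b<b′)))
  ... | tri> _ _ b′<b = ⊥-elim (s↑ (lose t∈T (refl , b′<b)))
  ... | tri≈ _ b≡b′ _ = unraisable-unique t∈T s∈T refl b≡b′ t↑₃ s↑₃

  data Kind (t : Triple) : Set where
    raisable-third  : RaisableThird t → Kind t
    raisable-second : ¬ RaisableThird t → RaisableSecond t → Kind t
    unraisable      : ¬ RaisableThird t → ¬ RaisableSecond t → Kind t

  kind : ∀ t → Kind t
  kind t with any? (t ⊏₃?_) T | any? (t ⊏₂?_) T
  ... | yes t↑₃ | _       = raisable-third t↑₃
  ... | no  t↑₃ | yes t↑₂ = raisable-second t↑₃ t↑₂
  ... | no  t↑₃ | no  t↑₂ = unraisable t↑₃ t↑₂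

  charge : ∀ {t} → t ∈ T → Kind t → Fin (n * 3)
  charge t∈T (raisable-third _)    = combine (fromℕ< (third<n t∈T)) 0F
  charge t∈T (raisable-second _ _) = combine (fromℕ< (second<n t∈T)) 1F
  charge t∈T (unraisable _ _)      = combine (fromℕ< (first<n t∈T)) 2F

  charge-injective : ∀ {t s} (t∈T : t ∈ T) (s∈T : s ∈ T) (k : Kind t) (l : Kind s) →
                     charge t∈T k ≡ charge s∈T l → t ≡ s
  charge-injective t∈T s∈T (raisable-third t↑) (raisable-third s↑) e =
    third-determines t∈T s∈T t↑ s↑ (proj₁ (pair-injective (third<n t∈T) (third<n s∈T) e))
  charge-injective t∈T s∈T (raisable-second t↑₃ t↑) (raisable-second s↑₃ s↑) e =
    second-determines t∈T s∈T t↑₃ s↑₃ t↑ s↑ (proj₁ (pair-injective (second<n t∈T) (second<n s∈T) e))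
  charge-injective t∈T s∈T (unraisable t↑₃ t↑₂) (unraisable s↑₃ s↑₂) e =
    first-determines t∈T s∈T t↑₃ s↑₃ t↑₂ s↑₂ (proj₁ (pair-injective (first<n t∈T) (first<n s∈T) e))
  charge-injective t∈T s∈T (raisable-third _) (raisable-second _ _) e
    with () ← proj₂ (pair-injective (third<n t∈T) (second<n s∈T) e)
  charge-injective t∈T s∈T (raisable-third _) (unraisable _ _) e
    with () ← proj₂ (pair-injective (third<n t∈T) (first<n s∈T) e)
  charge-injective t∈T s∈T (raisable-second _ _) (raisable-third _) e
    with () ← proj₂ (pair-injective (second<n t∈T) (third<n s∈T) e)
  charge-injective t∈T s∈T (raisable-second _ _) (unraisable _ _) e
    with () ← proj₂ (pair-injective (second<n t∈T) (first<n s∈T) e)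
  charge-injective t∈T s∈T (unraisable _ _) (raisable-third _) e
    with () ← proj₂ (pair-injective (first<n t∈T) (third<n s∈T) e)
  charge-injective t∈T s∈T (unraisable _ _) (raisable-second _ _) e
    with () ← proj₂ (pair-injective (first<n t∈T) (second<n s∈T) e)

  length-bound : Unique T → length T ≤ n * 3
  length-bound distinct = unique-length≤ distinct (λ {t} t∈T → charge t∈T (kind t))
    (λ {t} {s} t∈T s∈T → charge-injective t∈T s∈T (kind t) (kind s))

module AdmissibleCorners {n : ℕ} {F : List (Subset n)} (adm : Admissible n F) where

  private
    shape : ∀ {t} → t ∈ F → elements t ≡ vertexList (corners t) × SplitAt ⌈ n /2⌉ n (corners t)
    shape {t} t∈F = topBottom-corners t (All.lookup (proj₁ (proj₂ adm)) t∈F)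

    labelWord≡word : ∀ {t s} → t ∈ F → s ∈ F → labelWord t s ≡ word (corners t) (corners s)
    labelWord≡word {t} {s} t∈F s∈F =
      trans (labelWord≡merge t s) (cong₂ merge (proj₁ (shape t∈F)) (proj₁ (shape s∈F)))

    corners-injective : ∀ {t s} → t ∈ F → s ∈ F → corners t ≡ corners s → t ≡ s
    corners-injective {t} {s} t∈F s∈F e = elements-injective t s
      (trans (proj₁ (shape t∈F)) (trans (cong vertexList e) (sym (proj₁ (shape s∈F)))))

  distinct : Unique (map corners F)
  distinct = unique-map corners-injective (proj₁ adm)

  split : All (SplitAt ⌈ n /2⌉ n) (map corners F)
  split = All.map⁺ (All.tabulate (λ t∈F → proj₂ (shape t∈F)))

  free : ∀ {t′ s′} → t′ ∈ map corners F → s′ ∈ map corners F → t′ ≢ s′ → ¬ Forbidden (word t′ s′)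
  free t′∈ s′∈ t′≢s′ forbidden with ∈-map⁻ corners t′∈ | ∈-map⁻ corners s′∈
  ... | t , t∈F , refl | s , s∈F , refl =
    proj₂ (proj₂ adm) t∈F s∈F (λ t≡s → t′≢s′ (cong corners t≡s))
      (subst Forbidden (sym (labelWord≡word t∈F s∈F)) forbidden)

admissible-length≤ : ∀ {n} {F : List (Subset n)} → Admissible n F → length F ≤ 3 * n
admissible-length≤ {n} {F} adm = begin
  length F               ≡⟨ length-map corners F ⟨
  length (map corners F) ≤⟨ FreeFamily.length-bound split free distinct ⟩
  n * 3                  ≡⟨ *-comm n 3 ⟩
  3 * n                  ∎
  where
  open ≤-Reasoning
  open AdmissibleCorners adm

theorem9 : ∃[ C ] ∃[ n₀ ] ∀ n → n₀ ≤ n → (F : List (Subset n)) →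
             Admissible n F → length F ≤ C * n
theorem9 = 3 , 0 , λ _ _ _ → admissible-length≤
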